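{- For every $d\ge 2$, $k\ge 1$ and $0\le j\le d-1$, $$\alpha(X(d,k,j))=k+1=\frac{|V(X(d,k,j))|-2-j}{2d-2}+1.$$ For every $d\ge 3$, $k\ge 1$ and $1\le j\le d-1$, $$\alpha(Y(d,k,j))=k+2=\frac{|V(Y(d,k,j))|-2+(d-1-j)}{2d-2}+1.$$
   Context: For a graph $G$, $\alpha(G)$ is the maximum size of a stable set (set of pairwise non-adjacent vertices). The clique complex $\mathit{cl}(G)$ is the simplicial complex of cliques of $G$. Fix integers $d\ge 2$, $k\ge1$. The graph $W_{d,k}$ has vertex set $\{a,b\}\cup X_1\cup\dots\cup X_k$ (pairwise disjoint), where $X_i=\{y^i_1,\dots,y^i_{d-1},z^i_1,\dots,z^i_{d-1}\}$ has $2d-2$ elements. Its edges are: $a$ is adjacent to every vertex of $X_1$ and $b$ to every vertex of $X_k$, with no other edges at $a,b$ (and $ab$ is not an edge); within each $X_i$ all pairs are edges except the pairs $y^i_sz^i_s$, $s=1,\dots,d-1$ (so $W_{d,k}[X_i]$ is the graph of the $(d-1)$-dimensional crosspolytope); there are no edges between $X_i$ and $X_j$ when $|i-j|>1$; for $1\le i\le k-1$ and $s,t\in\{1,\dots,d-1\}$: if $t\ge s$ then $y^i_sy^{i+1}_t$ and $z^i_sz^{i+1}_t$ are edges while $y^i_sz^{i+1}_t$ and $z^i_sy^{i+1}_t$ are not, and if $t<s$ then $y^i_sz^{i+1}_t$ and $z^i_sy^{i+1}_t$ are edges while $y^i_sy^{i+1}_t$ and $z^i_sz^{i+1}_t$ are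 not. There are no other edges. For a simplicial complex $Z$ and an edge $xy$ of $Z$, $Z(xy)$ denotes the stellar subdivision of $Z$ at $xy$ (edge subdivision), which introduces a new vertex $v_{xy}$. Set $X''(d,k,0)=\mathit{cl}(W_{d,k})$ and for $j=1,\dots,d-1$ let $X''(d,k,j)=X''(d,k,j-1)(ay^1_j)$, with new vertex $u_j=v_{ay^1_j}$. Set $Y''(d,k,0)=X''(d,k,d-1)$ and for $j=1,\dots,d-1$ let $Y''(d,k,j)=Y''(d,k,j-1)(by^k_j)$, with new vertex $w_j=v_{by^k_j}$. Let $X(d,k,j)$ and $Y(d,k,j)$ be the graphs ($1$-skeleta) of $X''(d,k,j)$ and $Y''(d,k,j)$ respectively. -}

module Defs where

open import Data.Nat using (ℕ; zero; suc; _+_; _*_; _∸_; _≤_; _<_)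
open import Data.List using (List; []; _∷_; [_]; length)
open import Data.List.Membership.Propositional using (_∈_; _∉_)
open import Data.List.Relation.Unary.All using (All)
open import Data.List.Relation.Unary.Unique.Propositional using (Unique)
open import Data.Product using (Σ; ∃; _×_; _,_)
open import Data.Sum using (_⊎_)
open import Relation.Nullary using (¬_)
open import Relation.Binary.PropositionalEquality using (_≡_; _≢_)

-- Vertex names.  y i s = y^i_s, z i s = z^i_s, u j = u_j, w j = w_j.
-- Indices are natural numbers; which names are actual vertices is
-- governed by the validity predicate IsV below.

data Vtx : Set where
  a b : Vtx
  y z : ℕ → ℕ → Vtx
  u w : ℕ → Vtx

data IsV (d k : ℕ) : Vtx → Set where
  va : IsV d k a
  vb : IsV d k b
  vy : ∀ {i s} → 1 ≤ i → i ≤ k → 1 ≤ s → s ≤ d ∸ 1 → IsV d k (y i s)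
  vz : ∀ {i s} → 1 ≤ i → i ≤ k → 1 ≤ s → s ≤ d ∸ 1 → IsV d k (z i s)

data E (d k : ℕ) : Vtx → Vtx → Set where
  a-y : ∀ {s} → IsV d k (y 1 s) → E d k a (y 1 s)
  a-z : ∀ {s} → IsV d k (z 1 s) → E d k a (z 1 s)
  b-y : ∀ {s} → IsV d k (y k s) → E d k b (y k s)
  b-z : ∀ {s} → IsV d k (z k s) → E d k b (z k s)
  yy : ∀ {i s t} → IsV d k (y i s) → IsV d k (y i t) → s ≢ t → E d k (y i s) (y i t)
  zz : ∀ {i s t} → IsV d k (z i s) → IsV d k (z i t) → s ≢ t → E d k (z i s) (z i t)
  yz : ∀ {i s t} → IsV d k (y i s) → IsV d k (z i t) → s ≢ t → E d k (y i s) (z i t)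
  yy' : ∀ {i s t} → IsV d k (y i s) → IsV d k (y (suc i) t) → s ≤ t → E d k (y i s) (y (suc i) t)
  zz' : ∀ {i s t} → IsV d k (z i s) → IsV d k (z (suc i) t) → s ≤ t → E d k (z i s) (z (suc i) t)
  yz' : ∀ {i s t} → IsV d k (y i s) → IsV d k (z (suc i) t) → t < s → E d k (y i s) (z (suc i) t)
  zy' : ∀ {i s t} → IsV d k (z i s) → IsV d k (y (suc i) t) → t < s → E d k (z i s) (y (suc i) t)

Adj : ℕ → ℕ → Vtx → Vtx → Set
Adj d k p q = E d k p q ⊎ E d k q p

-- Simplicial complexes on Vtx, given by their face predicate
-- (a face is a finite set, represented by any list enumerating it).

Complex : Set₁
Complex = List Vtx → Set

cl : ℕ → ℕ → Complex
cl d k σ = All (IsV d k) σ × (∀ p q → p ∈ σ → q ∈ σ → p ≢ q → Adj d k p q)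

-- stellar subdivision Z(xy) with new vertex v (v not a vertex of Z):
-- faces are the faces of Z not containing {x,y}, and the sets {v} ∪ τ
-- with τ not containing {x,y} and τ ∪ {x,y} a face of Z.
stellar : Complex → Vtx → Vtx → Vtx → Complex
stellar K x x' v σ =
    (v ∉ σ × K σ × ¬ (x ∈ σ × x' ∈ σ))
  ⊎ (Σ (List Vtx) λ τ → v ∉ τ × (∀ t → (t ∈ σ → t ≡ v ⊎ t ∈ τ) × (t ≡ v ⊎ t ∈ τ → t ∈ σ))
        × ¬ (x ∈ τ × x' ∈ τ) × K (x ∷ x' ∷ τ))

X'' : ℕ → ℕ → ℕ → Complex
X'' d k zero = cl d k
X'' d k (suc j) = stellar (X'' d k j) a (y 1 (suc j)) (u (suc j))

Y'' : ℕ → ℕ → ℕ → Complex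
Y'' d k zero = X'' d k (d ∸ 1)
Y'' d k (suc j) = stellar (Y'' d k j) b (y k (suc j)) (w (suc j))

Vert : Complex → Vtx → Set
Vert K p = K [ p ]

Edge : Complex → Vtx → Vtx → Set
Edge K p q = p ≢ q × K (p ∷ q ∷ [])

Stable : Complex → List Vtx → Set
Stable K S = Unique S × All (Vert K) S × (∀ p q → p ∈ S → q ∈ S → ¬ Edge K p q)

IsAlpha : Complex → ℕ → Set
IsAlpha K n = (Σ (List Vtx) λ S → Stable K S × length S ≡ n)
            × (∀ S → Stable K S → length S ≤ n)

NumVerts : Complex → ℕ → Set
NumVerts K n = Σ (List Vtx) λ L → Unique L × (∀ p → (p ∈ L → Vert K p) × (Vert K p → p ∈ L)) × length L ≡ n

module Submission where

-- Each stellar subdivision keeps the old faces that avoid the subdivided edge and adds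
-- exactly one vertex, which gives the vertex counts, and it never creates an edge between
-- two old vertices.
--
-- Upper bound for X: in a stable set S put a and the u_j on level 0, b on level k, y^i_s
-- on level i, and z^i_s on level i - 1 if y^i_s ∈ S and on level i otherwise. Two vertices
-- of S on the same level are adjacent, so S has at most k + 1 elements. Upper bound for Y:
-- b and the w_j form a clique, and the other vertices of a stable set of Y are stable in
-- X(d,k,d-1).
--
-- Lower bounds: b together with the pairs y^i_1, z^i_1 on every other layer below k (and a
-- when k is odd) is stable in X. In Y, a, b and one index-1 vertex on each layer k, ..., 1
-- are stable, because the subdivisions separate a from y^1_1, y^1_2 and b from y^k_1.

open import Defs
open import Function using (_∘_; id; case_of_)
open import Data.Bool using (Bool; true; false; not)
open import Data.Empty using (⊥; ⊥-elim)
open import Data.Nat using (ℕ; zero; suc; _+_; _*_; _∸_; _≤_; _<_; _≤′_; ≤′-refl; ≤′-step; z≤n; s≤s)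
open import Data.Nat.Properties
open import Data.Nat.Tactic.RingSolver using (solve-∀)
open import Data.Product using (Σ; ∃; ∃₂; _×_; _,_; proj₁; proj₂; uncurry)
open import Data.Product.Properties using (≡-dec)
open import Data.Sum using (_⊎_; inj₁; inj₂; swap)
open import Data.List using (List; []; _∷_; [_]; _++_; length; map; filter; applyUpTo; cartesianProductWith)
open import Data.List.Properties
  using (filter-all; filter-accept; filter-reject; length-map; length-++; length-applyUpTo)
open import Data.List.Membership.Propositional using (_∈_; _∉_)
open import Data.List.Membership.Propositional.Properties
  using ( ∈-++⁻; ∈-++⁺ˡ; ∈-++⁺ʳ; ∈-filter⁻; ∈-applyUpTo⁺; ∈-applyUpTo⁻
        ; ∈-cartesianProductWith⁺; ∈-cartesianProductWith⁻)
open import Data.List.Relation.Unary.Any using (here; there)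
open import Data.List.Relation.Unary.All as All using (All; []; _∷_)
open import Data.List.Relation.Unary.All.Properties
  using (¬Any⇒All¬; All¬⇒¬Any; all-filter) renaming (map⁺ to All-map⁺)
open import Data.List.Relation.Unary.AllPairs as AllPairs using (AllPairs; []; _∷_)
open import Data.List.Relation.Unary.Unique.Propositional using (Unique)
import Data.List.Relation.Unary.Unique.Propositional.Properties as Unique
open import Relation.Nullary using (¬_; Dec; yes; no; contradiction)
open import Relation.Nullary.Decidable using (map′)
open import Relation.Unary using (Decidable)
open import Relation.Unary.Properties using (∁?)
open import Relation.Binary using (tri<; tri≈; tri>)
open import Relation.Binary.PropositionalEquality
  using (_≡_; _≢_; refl; sym; trans; cong; cong₂; subst; module ≡-Reasoning)

code : Vtx → ℕ × ℕ × ℕ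
code a = 0 , 0 , 0
code b = 1 , 0 , 0
code (y i s) = 2 , i , s
code (z i s) = 3 , i , s
code (u s) = 4 , s , 0
code (w s) = 5 , s , 0

code-injective : ∀ {p q} → code p ≡ code q → p ≡ q
code-injective {a} {a} refl = refl
code-injective {b} {b} refl = refl
code-injective {y _ _} {y _ _} refl = refl
code-injective {z _ _} {z _ _} refl = refl
code-injective {u _} {u _} refl = refl
code-injective {w _} {w _} refl = refl

_≟ᵥ_ : (p q : Vtx) → Dec (p ≡ q)
p ≟ᵥ q = map′ code-injective (cong code) (≡-dec _≟_ (≡-dec _≟_ _≟_) (code p) (code q))

open import Data.List.Membership.DecPropositional _≟ᵥ_ using (_∈?_)

y-injective : ∀ {i s t} → y i s ≡ y i t → s ≡ t
y-injective refl = refl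

u-injective : ∀ {s t} → u s ≡ u t → s ≡ t
u-injective refl = refl

w-injective : ∀ {s t} → w s ≡ w t → s ≡ t
w-injective refl = refl

Cone : List Vtx → Vtx → List Vtx → Set
Cone σ v τ = ∀ t → (t ∈ σ → t ≡ v ⊎ t ∈ τ) × (t ≡ v ⊎ t ∈ τ → t ∈ σ)

cone-∷ : ∀ {v τ} → Cone (v ∷ τ) v τ
cone-∷ t = (λ { (here t≡v) → inj₁ t≡v ; (there t∈τ) → inj₂ t∈τ })
         , (λ { (inj₁ t≡v) → here t≡v ; (inj₂ t∈τ) → there t∈τ })

cone-∷ʳ : ∀ {v} τ → Cone (τ ++ [ v ]) v τ
cone-∷ʳ τ t = to , from
  where
  to : t ∈ τ ++ [ _ ] → _
  to t∈ with ∈-++⁻ τ t∈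
  ... | inj₁ t∈τ = inj₂ t∈τ
  ... | inj₂ (here t≡v) = inj₁ t≡v
  from : _ → t ∈ τ ++ [ _ ]
  from (inj₁ t≡v) = ∈-++⁺ʳ τ (here t≡v)
  from (inj₂ t∈τ) = ∈-++⁺ˡ t∈τ

NoPair : Complex → Vtx → Vtx → Set
NoPair K p q = ∀ {σ} → K σ → p ∈ σ → q ∈ σ → ⊥

OldPairsIn : Complex → (Vtx → Set) → (Vtx → Vtx → Set) → Set
OldPairsIn K Old R = ∀ {σ p q} → K σ → p ∈ σ → q ∈ σ → p ≢ q → Old p → Old q → R p q

Enumerates : Complex → List Vtx → Set
Enumerates K L = Unique L × (∀ p → (p ∈ L → Vert K p) × (Vert K p → p ∈ L))

enumerates⇒numVerts : ∀ K {L} → Enumerates K L → NumVerts K (length L)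
enumerates⇒numVerts _ (unique , members) = _ , unique , members , refl

module _ {K : Complex} {x x' v : Vtx} where

  stellar-old : ∀ {σ} → K σ → v ∉ σ → ¬ (x ∈ σ × x' ∈ σ) → stellar K x x' v σ
  stellar-old kσ v∉σ ¬xx' = inj₁ (v∉σ , kσ , ¬xx')

  stellar-cone : ∀ {σ τ} → K (x ∷ x' ∷ τ) → v ∉ τ → ¬ (x ∈ τ × x' ∈ τ) → Cone σ v τ →
                 stellar K x x' v σ
  stellar-cone kτ v∉τ ¬xx' σ≈ = inj₂ (_ , v∉τ , σ≈ , ¬xx' , kτ)

  stellar-new-vertex : K (x ∷ x' ∷ []) → stellar K x x' v [ v ]
  stellar-new-vertex kxx' = stellar-cone kxx' (λ ()) (λ { (() , _) }) cone-∷

  stellar-vertex⁻ : ∀ {p} → Vert (stellar K x x' v) p → p ≡ v ⊎ Vert K p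
  stellar-vertex⁻ (inj₁ (_ , kp , _)) = inj₂ kp
  stellar-vertex⁻ (inj₂ (_ , _ , σ≈ , _ , _)) with proj₂ (σ≈ v) (inj₁ refl)
  ... | here v≡p = inj₁ (sym v≡p)

  stellar-separates : v ≢ x → v ≢ x' → NoPair (stellar K x x' v) x x'
  stellar-separates _ _ (inj₁ (_ , _ , ¬xx')) x∈σ x'∈σ = ¬xx' (x∈σ , x'∈σ)
  stellar-separates v≢x v≢x' (inj₂ (_ , _ , σ≈ , ¬xx' , _)) x∈σ x'∈σ
    with proj₁ (σ≈ x) x∈σ | proj₁ (σ≈ x') x'∈σ
  ... | inj₁ x≡v | _ = v≢x (sym x≡v)
  ... | inj₂ _ | inj₁ x'≡v = v≢x' (sym x'≡v)
  ... | inj₂ x∈τ | inj₂ x'∈τ = ¬xx' (x∈τ , x'∈τ)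

  stellar-noPair : ∀ {p q} → v ≢ p → v ≢ q → NoPair K p q → NoPair (stellar K x x' v) p q
  stellar-noPair _ _ sep (inj₁ (_ , kσ , _)) p∈σ q∈σ = sep kσ p∈σ q∈σ
  stellar-noPair v≢p v≢q sep (inj₂ (_ , _ , σ≈ , _ , kτ)) p∈σ q∈σ
    with proj₁ (σ≈ _) p∈σ | proj₁ (σ≈ _) q∈σ
  ... | inj₁ p≡v | _ = v≢p (sym p≡v)
  ... | inj₂ _ | inj₁ q≡v = v≢q (sym q≡v)
  ... | inj₂ p∈τ | inj₂ q∈τ = sep kτ (there (there p∈τ)) (there (there q∈τ))

  stellar-oldPairs : ∀ {Old R} → ¬ Old v → OldPairsIn K Old R → OldPairsIn (stellar K x x' v) Old R
  stellar-oldPairs _ old (inj₁ (_ , kσ , _)) p∈σ q∈σ = old kσ p∈σ q∈σ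
  stellar-oldPairs ¬old-v old (inj₂ (_ , _ , σ≈ , _ , kτ)) p∈σ q∈σ p≢q old-p old-q
    with proj₁ (σ≈ _) p∈σ | proj₁ (σ≈ _) q∈σ
  ... | inj₁ refl | _ = ⊥-elim (¬old-v old-p)
  ... | inj₂ _ | inj₁ refl = ⊥-elim (¬old-v old-q)
  ... | inj₂ p∈τ | inj₂ q∈τ = old kτ (there (there p∈τ)) (there (there q∈τ)) p≢q old-p old-q

  stellar-enumerates : ∀ {L} → x ≢ x' → K (x ∷ x' ∷ []) → v ∉ L →
                       Enumerates K L → Enumerates (stellar K x x' v) (v ∷ L)
  stellar-enumerates {L} x≢x' kxx' v∉L (unique , members) =
    ¬Any⇒All¬ L v∉L ∷ unique , λ p → to , from
    where
    to : ∀ {p} → p ∈ v ∷ L → Vert (stellar K x x' v) p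
    to (here refl) = stellar-new-vertex kxx'
    to (there p∈L) = stellar-old (proj₁ (members _) p∈L) (λ { (here refl) → v∉L p∈L })
                                 (λ { (here refl , here refl) → x≢x' refl })
    from : ∀ {p} → Vert (stellar K x x' v) p → p ∈ v ∷ L
    from vp with stellar-vertex⁻ vp
    ... | inj₁ p≡v = here p≡v
    ... | inj₂ vp′ = there (proj₂ (members _) vp′)

-- S is a parameter related to its subdivisions by unfold/fold (rather than defined by
-- recursion), so that X'' and Y'' instantiate it with the identity.
module Iterated (S : ℕ → Complex) (x : Vtx) (f g : ℕ → Vtx)
  (unfold : ∀ {j σ} → stellar (S j) x (f (suc j)) (g (suc j)) σ → S (suc j) σ)
  (fold : ∀ {j σ} → S (suc j) σ → stellar (S j) x (f (suc j)) (g (suc j)) σ)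
  (f≢x : ∀ {s} → f s ≢ x) (g≢x : ∀ {s} → g s ≢ x) (g≢f : ∀ {s t} → g s ≢ f t)
  (f-injective : ∀ {s t} → f s ≡ f t → s ≡ t) (g-injective : ∀ {s t} → g s ≡ g t → s ≡ t)
  where

  f-distinct : ∀ {s t} → s ≢ t → f s ≢ f t
  f-distinct s≢t = s≢t ∘ f-injective

  g-distinct : ∀ {s t} → s ≢ t → g s ≢ g t
  g-distinct s≢t = s≢t ∘ g-injective

  private
    lift′ : ∀ {m j σ} → m ≤′ j → S m σ → (∀ {t} → m < t → t ≤ j → g t ∉ σ) →
            (∀ {t} → m < t → t ≤ j → ¬ (x ∈ σ × f t ∈ σ)) → S j σ
    lift′ ≤′-refl sσ _ _ = sσ
    lift′ (≤′-step m≤′j) sσ new∉ ¬xf =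
      unfold (stellar-old {K = S _}
                 (lift′ m≤′j sσ (λ m<t → new∉ m<t ∘ m≤n⇒m≤1+n) (λ m<t → ¬xf m<t ∘ m≤n⇒m≤1+n))
                 (new∉ m<1+j ≤-refl) (¬xf m<1+j ≤-refl))
      where m<1+j = s≤s (≤′⇒≤ m≤′j)

  lift : ∀ {m j σ} → m ≤ j → S m σ → (∀ {t} → m < t → t ≤ j → g t ∉ σ) →
         (∀ {t} → m < t → t ≤ j → ¬ (x ∈ σ × f t ∈ σ)) → S j σ
  lift = lift′ ∘ ≤⇒≤′

  private
    edge-from-triangle : ∀ {s J q} → suc s ≤ J → S s (x ∷ f (suc s) ∷ q ∷ []) →
                         (∀ {t} → suc s ≤ t → g t ≢ q) → S J (g (suc s) ∷ q ∷ [])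
    edge-from-triangle {s} s<J triangle g≢q =
      lift s<J (unfold (stellar-cone {K = S s} triangle (All¬⇒¬Any (g≢q ≤-refl ∷ []))
                                     (λ { (here x≡q , here f≡q) → f≢x (trans f≡q (sym x≡q)) }) cone-∷))
        (λ s<t _ → All¬⇒¬Any (g-distinct (>⇒≢ s<t) ∷ g≢q (<⇒≤ s<t) ∷ []))
        (λ _ _ → λ { (here x≡g , _) → g≢x (sym x≡g)
                   ; (there (here _) , here f≡g) → g≢f (sym f≡g)
                   ; (there (here x≡q) , there (here f≡q)) → f≢x (trans f≡q (sym x≡q)) })

  edge-to-old : ∀ {s J q} → 1 ≤ s → s ≤ J → S 0 (x ∷ f s ∷ q ∷ []) →
                (∀ {t} → g t ≢ q) → (∀ {t} → t < s → f t ≢ q) → Edge (S J) (g s) q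
  edge-to-old {suc s} _ s<J triangle g≢q f≢q =
    g≢q , edge-from-triangle s<J triangle′ (λ _ → g≢q)
    where
    triangle′ : S s (x ∷ f (suc s) ∷ _ ∷ [])
    triangle′ = lift z≤n triangle (λ _ _ → All¬⇒¬Any (g≢x ∷ g≢f ∷ g≢q ∷ []))
      (λ _ t≤s (_ , f∈) → All¬⇒¬Any (f≢x ∷ f-distinct (<⇒≢ (s≤s t≤s)) ∷ f≢q (s≤s t≤s) ∷ []) f∈)

  -- At stage t the face {x, f t, f s} is coned to {g t, x, f s}; that face survives to
  -- stage s - 1, and coning it at stage s yields the edge g s g t.
  edge-to-new : ∀ {s t J} → 1 ≤ t → t < s → s ≤ J → S 0 (x ∷ f t ∷ x ∷ f s ∷ []) →
                Edge (S J) (g s) (g t)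
  edge-to-new {suc s} {suc t} _ t<s s≤J square =
    g-distinct (>⇒≢ t<s) , edge-from-triangle s≤J triangle (λ s<r → g-distinct (>⇒≢ (<-≤-trans t<s s<r)))
    where
    square′ : S t (x ∷ f (suc t) ∷ x ∷ f (suc s) ∷ [])
    square′ = lift z≤n square (λ _ _ → All¬⇒¬Any (g≢x ∷ g≢f ∷ g≢x ∷ g≢f ∷ []))
      (λ _ r≤t (_ , f∈) → All¬⇒¬Any (f≢x ∷ f-distinct (<⇒≢ (s≤s r≤t)) ∷ f≢x
                                       ∷ f-distinct (<⇒≢ (<-trans (s≤s r≤t) t<s)) ∷ []) f∈)
    triangle₀ : S (suc t) (x ∷ f (suc s) ∷ g (suc t) ∷ [])
    triangle₀ = unfold (stellar-cone {K = S t} square′ (All¬⇒¬Any (g≢x ∷ g≢f ∷ []))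
      (λ (_ , f∈) → All¬⇒¬Any (f≢x ∷ f-distinct (<⇒≢ t<s) ∷ []) f∈) (cone-∷ʳ (x ∷ f (suc s) ∷ [])))
    triangle : S s (x ∷ f (suc s) ∷ g (suc t) ∷ [])
    triangle = lift (≤-pred t<s) triangle₀
      (λ t<r _ → All¬⇒¬Any (g≢x ∷ g≢f ∷ g-distinct (>⇒≢ t<r) ∷ []))
      (λ _ r≤s (_ , f∈) → All¬⇒¬Any (f≢x ∷ f-distinct (<⇒≢ (s≤s r≤s)) ∷ (g≢f ∘ sym) ∷ []) f∈)

  separated : ∀ {J s} → 1 ≤ s → s ≤ J → NoPair (S J) x (f s)
  separated {zero} (s≤s _) ()
  separated {suc J} 1≤s s≤1+J with m≤n⇒m<n∨m≡n s≤1+J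
  ... | inj₂ refl = stellar-separates {K = S J} g≢x g≢f ∘ fold
  ... | inj₁ s<1+J = stellar-noPair g≢x g≢f (separated 1≤s (≤-pred s<1+J)) ∘ fold

  noPair-lift : ∀ {J p q} → (∀ {t} → g t ≢ p) → (∀ {t} → g t ≢ q) → NoPair (S 0) p q → NoPair (S J) p q
  noPair-lift {zero} _ _ sep = sep
  noPair-lift {suc J} g≢p g≢q sep = stellar-noPair g≢p g≢q (noPair-lift g≢p g≢q sep) ∘ fold

  oldPairs-lift : ∀ {J Old R} → (∀ {t} → ¬ Old (g t)) → OldPairsIn (S 0) Old R → OldPairsIn (S J) Old R
  oldPairs-lift {zero} _ old = old
  oldPairs-lift {suc J} ¬old old = stellar-oldPairs ¬old (oldPairs-lift ¬old old) ∘ fold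

  news : ℕ → List Vtx
  news zero = []
  news (suc j) = g (suc j) ∷ news j

  length-news : ∀ j → length (news j) ≡ j
  length-news zero = refl
  length-news (suc j) = cong suc (length-news j)

  ∈-news⁻ : ∀ {j p} → p ∈ news j → ∃ λ s → 1 ≤ s × s ≤ j × p ≡ g s
  ∈-news⁻ {suc j} (here p≡g) = suc j , s≤s z≤n , ≤-refl , p≡g
  ∈-news⁻ {suc j} (there p∈) with ∈-news⁻ p∈
  ... | s , 1≤s , s≤j , p≡g = s , 1≤s , m≤n⇒m≤1+n s≤j , p≡g

  enumerates : ∀ {L} J → (∀ {s} → 1 ≤ s → s ≤ J → S 0 (x ∷ f s ∷ [])) → (∀ {t} → g t ∉ L) →
               Enumerates (S 0) L → Enumerates (S J) (news J ++ L)
  enumerates zero _ _ enum = enum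
  enumerates {L} (suc J) edge g∉L enum =
    unfold-enumerates (stellar-enumerates {K = S J} (f≢x ∘ sym) edge-at-J fresh
                                          (enumerates J (λ 1≤s → edge 1≤s ∘ m≤n⇒m≤1+n) g∉L enum))
    where
    unfold-enumerates : ∀ {L′} → Enumerates (stellar (S J) x (f (suc J)) (g (suc J))) L′ →
                        Enumerates (S (suc J)) L′
    unfold-enumerates (unique , members) = unique , λ p → unfold ∘ proj₁ (members p) , proj₂ (members p) ∘ fold
    edge-at-J : S J (x ∷ f (suc J) ∷ [])
    edge-at-J = lift z≤n (edge (s≤s z≤n) ≤-refl) (λ _ _ → All¬⇒¬Any (g≢x ∷ g≢f ∷ []))
      (λ _ t≤J (_ , f∈) → All¬⇒¬Any (f≢x ∷ f-distinct (<⇒≢ (s≤s t≤J)) ∷ []) f∈)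
    fresh : g (suc J) ∉ news J ++ L
    fresh g∈ with ∈-++⁻ (news J) g∈
    ... | inj₁ g∈news with ∈-news⁻ g∈news
    ...   | _ , _ , s≤J , g≡g = 1+n≰n (≤-trans (≤-reflexive (g-injective g≡g)) s≤J)
    fresh g∈ | inj₂ g∈L = g∉L g∈L

length≤filter< : ∀ {n xs} → Unique xs → All (_< suc n) xs → length xs ≤ suc (length (filter (_<? n) xs))
length≤filter< {n} {[]} _ _ = z≤n
length≤filter< {n} {x ∷ xs} (x∉xs ∷ unique) (x≤n ∷ below) with x <? n
... | yes x<n rewrite filter-accept (_<? n) {xs = xs} x<n = s≤s (length≤filter< unique below)
... | no x≮n rewrite filter-reject (_<? n) {xs = xs} x≮n =
  s≤s (≤-reflexive (sym (cong length (filter-all (_<? n) xs<n))))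
  where
  x≡n : x ≡ n
  x≡n = ≤-antisym (≤-pred x≤n) (≮⇒≥ x≮n)
  xs<n : All (_< n) xs
  xs<n = All.tabulate λ t∈xs →
    ≤∧≢⇒< (≤-pred (All.lookup below t∈xs)) (λ t≡n → All.lookup x∉xs t∈xs (trans x≡n (sym t≡n)))

length≤bound : ∀ n {xs} → Unique xs → All (_< n) xs → length xs ≤ n
length≤bound zero {[]} _ _ = z≤n
length≤bound zero {_ ∷ _} _ (() ∷ _)
length≤bound (suc n) {xs} unique below =
  ≤-trans (length≤filter< unique below)
          (s≤s (length≤bound n (Unique.filter⁺ (_<? n) unique) (all-filter (_<? n) xs)))

module _ {A : Set} (level : A → ℕ) where

  unique-map : ∀ {xs} → Unique xs → (∀ {p q} → p ∈ xs → q ∈ xs → level p ≡ level q → p ≡ q) →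
               Unique (map level xs)
  unique-map [] _ = []
  unique-map (x∉xs ∷ unique) injective =
    All-map⁺ (All.tabulate λ q∈xs → All.lookup x∉xs q∈xs ∘ injective (here refl) (there q∈xs))
    ∷ unique-map unique (λ p∈ q∈ → injective (there p∈) (there q∈))

  pigeonhole : ∀ n {xs} → Unique xs → (∀ {p q} → p ∈ xs → q ∈ xs → level p ≡ level q → p ≡ q) →
               (∀ {p} → p ∈ xs → level p < n) → length xs ≤ n
  pigeonhole n {xs} unique injective below =
    subst (_≤ n) (length-map level xs)
          (length≤bound n (unique-map unique injective) (All-map⁺ (All.tabulate below)))

length≤1 : ∀ {A : Set} {xs : List A} → Unique xs → (∀ {p q} → p ∈ xs → q ∈ xs → p ≡ q) → length xs ≤ 1
length≤1 {xs = []} _ _ = z≤n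
length≤1 {xs = _ ∷ []} _ _ = ≤-refl
length≤1 {xs = _ ∷ _ ∷ _} ((p≢q ∷ _) ∷ _) all-equal =
  contradiction (all-equal (here refl) (there (here refl))) p≢q

length-partition : ∀ {A : Set} {P : A → Set} (P? : Decidable P) xs →
                   length xs ≡ length (filter P? xs) + length (filter (∁? P?) xs)
length-partition P? [] = refl
length-partition P? (x ∷ xs) with P? x
... | yes _ = cong suc (length-partition P? xs)
... | no _ = trans (cong suc (length-partition P? xs)) (sym (+-suc _ _))

length-cartesianProductWith : ∀ {A B C : Set} (f : A → B → C) xs ys →
                              length (cartesianProductWith f xs ys) ≡ length xs * length ys
length-cartesianProductWith f [] ys = refl
length-cartesianProductWith f (x ∷ xs) ys = begin
  length (map (f x) ys ++ cartesianProductWith f xs ys)          ≡⟨ length-++ (map (f x) ys) ⟩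
  length (map (f x) ys) + length (cartesianProductWith f xs ys)  ≡⟨ cong₂ _+_ (length-map (f x) ys)
                                                                          (length-cartesianProductWith f xs ys) ⟩
  length ys + length xs * length ys                              ∎
  where open ≡-Reasoning

NonAdjacent : Complex → Vtx → Vtx → Set
NonAdjacent K p q = p ≢ q × ¬ Edge K p q × ¬ Edge K q p

nonAdjacent-sym : ∀ {K p q} → NonAdjacent K p q → NonAdjacent K q p
nonAdjacent-sym (p≢q , ¬pq , ¬qp) = p≢q ∘ sym , ¬qp , ¬pq

nonAdjacent-noPair : ∀ {K p q} → p ≢ q → NoPair K p q → NonAdjacent K p q
nonAdjacent-noPair p≢q sep = p≢q , (λ (_ , kpq) → sep kpq (here refl) (there (here refl)))
                                 , (λ (_ , kqp) → sep kqp (there (here refl)) (here refl))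

stable : ∀ {K S} → AllPairs (NonAdjacent K) S → All (Vert K) S → Stable K S
stable {K} pairs vertices = AllPairs.map proj₁ pairs , vertices , no-edge pairs
  where
  no-edge : ∀ {S} → AllPairs (NonAdjacent K) S → ∀ p q → p ∈ S → q ∈ S → ¬ Edge K p q
  no-edge (_ ∷ _) p q (here refl) (here refl) (p≢p , _) = p≢p refl
  no-edge (p~ ∷ _) p q (here refl) (there q∈) = proj₁ (proj₂ (All.lookup p~ q∈))
  no-edge (q~ ∷ _) p q (there p∈) (here refl) = proj₂ (proj₂ (All.lookup q~ p∈))
  no-edge (_ ∷ pairs) p q (there p∈) (there q∈) = no-edge pairs p q p∈ q∈

module W (d k : ℕ) where

  layer : Vtx → ℕ
  layer a = 0
  layer b = suc k
  layer (y i _) = i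
  layer (z i _) = i
  layer (u _) = 0
  layer (w _) = 0

  E-layer : ∀ {p q} → E d k p q → layer q ≤ suc (layer p) × layer p ≤ suc (layer q)
  E-layer (a-y _) = ≤-refl , z≤n
  E-layer (a-z _) = ≤-refl , z≤n
  E-layer (b-y _) = m≤n⇒m≤1+n (n≤1+n k) , ≤-refl
  E-layer (b-z _) = m≤n⇒m≤1+n (n≤1+n k) , ≤-refl
  E-layer (yy _ _ _) = n≤1+n _ , n≤1+n _
  E-layer (zz _ _ _) = n≤1+n _ , n≤1+n _
  E-layer (yz _ _ _) = n≤1+n _ , n≤1+n _
  E-layer (yy' _ _ _) = ≤-refl , m≤n⇒m≤1+n (n≤1+n _)
  E-layer (zz' _ _ _) = ≤-refl , m≤n⇒m≤1+n (n≤1+n _)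
  E-layer (yz' _ _ _) = ≤-refl , m≤n⇒m≤1+n (n≤1+n _)
  E-layer (zy' _ _ _) = ≤-refl , m≤n⇒m≤1+n (n≤1+n _)

  layer-gap⇒¬Adj : ∀ {p q} → 2 + layer p ≤ layer q → ¬ Adj d k p q
  layer-gap⇒¬Adj gap (inj₁ e) = 1+n≰n (≤-trans gap (proj₁ (E-layer e)))
  layer-gap⇒¬Adj gap (inj₂ e) = 1+n≰n (≤-trans gap (proj₂ (E-layer e)))

  E-valid : ∀ {p q} → E d k p q → IsV d k p × IsV d k q
  E-valid (a-y v) = va , v
  E-valid (a-z v) = va , v
  E-valid (b-y v) = vb , v
  E-valid (b-z v) = vb , v
  E-valid (yy v v′ _) = v , v′
  E-valid (zz v v′ _) = v , v′
  E-valid (yz v v′ _) = v , v′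
  E-valid (yy' v v′ _) = v , v′
  E-valid (zz' v v′ _) = v , v′
  E-valid (yz' v v′ _) = v , v′
  E-valid (zy' v v′ _) = v , v′

  E-irreflexive : ∀ {p q} → E d k p q → p ≢ q
  E-irreflexive (yy _ _ s≢t) refl = s≢t refl
  E-irreflexive (zz _ _ s≢t) refl = s≢t refl
  E-irreflexive (yy' _ _ _) ()
  E-irreflexive (zz' _ _ _) ()

  ¬E-to-a : ∀ {p} → ¬ E d k p a
  ¬E-to-a ()

  clique : ∀ {σ} → All (IsV d k) σ → AllPairs (λ p q → p ≢ q → Adj d k p q) σ → cl d k σ
  clique valid adjacent = valid , λ p q p∈ q∈ → adj adjacent p∈ q∈
    where
    adj : ∀ {σ p q} → AllPairs (λ p q → p ≢ q → Adj d k p q) σ → p ∈ σ → q ∈ σ → p ≢ q → Adj d k p q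
    adj _ (here refl) (here refl) p≢p = contradiction refl p≢p
    adj (p~ ∷ _) (here refl) (there q∈) = All.lookup p~ q∈
    adj (q~ ∷ _) (there p∈) (here refl) p≢q = swap (All.lookup q~ p∈ (p≢q ∘ sym))
    adj (_ ∷ adjacent) (there p∈) (there q∈) = adj adjacent p∈ q∈

  cl-edge : ∀ {p q} → E d k p q → cl d k (p ∷ q ∷ [])
  cl-edge e = clique (proj₁ (E-valid e) ∷ proj₂ (E-valid e) ∷ []) (((λ _ → inj₁ e) ∷ []) ∷ [] ∷ [])

  cl-oldPairs : OldPairsIn (cl d k) (IsV d k) (Adj d k)
  cl-oldPairs (_ , adjacent) p∈ q∈ p≢q _ _ = adjacent _ _ p∈ q∈ p≢q

  range : ℕ → List ℕ
  range = applyUpTo suc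

  ∈-range⁺ : ∀ {i n} → 1 ≤ i → i ≤ n → i ∈ range n
  ∈-range⁺ {suc i} _ i≤n = ∈-applyUpTo⁺ suc i≤n

  ∈-range⁻ : ∀ {i n} → i ∈ range n → 1 ≤ i × i ≤ n
  ∈-range⁻ i∈ with ∈-applyUpTo⁻ suc i∈
  ... | _ , i<n , refl = s≤s z≤n , i<n

  grid : (ℕ → ℕ → Vtx) → List Vtx
  grid c = cartesianProductWith c (range k) (range (d ∸ 1))

  ∈-grid⁻ : ∀ {c p} → p ∈ grid c → ∃₂ λ i s → (1 ≤ i × i ≤ k) × (1 ≤ s × s ≤ d ∸ 1) × p ≡ c i s
  ∈-grid⁻ {c} p∈ with ∈-cartesianProductWith⁻ c (range k) (range (d ∸ 1)) p∈
  ... | i , s , i∈ , s∈ , p≡ = i , s , ∈-range⁻ i∈ , ∈-range⁻ s∈ , p≡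

  W-vertices : List Vtx
  W-vertices = a ∷ b ∷ grid y ++ grid z

  IsV⇒∈W : ∀ {p} → IsV d k p → p ∈ W-vertices
  IsV⇒∈W va = here refl
  IsV⇒∈W vb = there (here refl)
  IsV⇒∈W (vy 1≤i i≤k 1≤s s≤d) =
    there (there (∈-++⁺ˡ (∈-cartesianProductWith⁺ y (∈-range⁺ 1≤i i≤k) (∈-range⁺ 1≤s s≤d))))
  IsV⇒∈W (vz 1≤i i≤k 1≤s s≤d) =
    there (there (∈-++⁺ʳ (grid y) (∈-cartesianProductWith⁺ z (∈-range⁺ 1≤i i≤k) (∈-range⁺ 1≤s s≤d))))

  ∈W⇒IsV : ∀ {p} → p ∈ W-vertices → IsV d k p
  ∈W⇒IsV (here refl) = va
  ∈W⇒IsV (there (here refl)) = vb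
  ∈W⇒IsV (there (there p∈)) with ∈-++⁻ (grid y) p∈
  ... | inj₁ p∈y with ∈-grid⁻ p∈y
  ...   | _ , _ , (1≤i , i≤k) , (1≤s , s≤d) , refl = vy 1≤i i≤k 1≤s s≤d
  ∈W⇒IsV (there (there p∈)) | inj₂ p∈z with ∈-grid⁻ p∈z
  ...   | _ , _ , (1≤i , i≤k) , (1≤s , s≤d) , refl = vz 1≤i i≤k 1≤s s≤d

  cl-enumerates : Enumerates (cl d k) W-vertices
  cl-enumerates = unique , λ p → (λ p∈ → clique (∈W⇒IsV p∈ ∷ []) ([] ∷ []))
                               , (λ (valid , _) → IsV⇒∈W (All.head valid))
    where
    grid-unique : ∀ c → (∀ {i j s t} → c i s ≡ c j t → i ≡ j × s ≡ t) → Unique (grid c)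
    grid-unique c injective = Unique.cartesianProductWith⁺ c injective (range-unique k) (range-unique (d ∸ 1))
      where range-unique : ∀ n → Unique (range n)
            range-unique n = Unique.applyUpTo⁺₁ suc n (λ i<j _ → <⇒≢ i<j ∘ suc-injective)
    not-in-grids : ∀ {p} → (∀ {i s} → p ≢ y i s) → (∀ {i s} → p ≢ z i s) → All (p ≢_) (grid y ++ grid z)
    not-in-grids p≢y p≢z = ¬Any⇒All¬ _ λ p∈ → case ∈-++⁻ (grid y) p∈ of λ
      { (inj₁ p∈y) → let _ , _ , _ , _ , p≡ = ∈-grid⁻ p∈y in p≢y p≡
      ; (inj₂ p∈z) → let _ , _ , _ , _ , p≡ = ∈-grid⁻ p∈z in p≢z p≡ }
    unique : Unique W-vertices
    unique = ((λ ()) ∷ not-in-grids (λ ()) (λ ()))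
           ∷ not-in-grids (λ ()) (λ ())
           ∷ Unique.++⁺ (grid-unique y λ { refl → refl , refl }) (grid-unique z λ { refl → refl , refl })
                        grids-disjoint
      where
      grids-disjoint : ∀ {p} → ¬ (p ∈ grid y × p ∈ grid z)
      grids-disjoint (p∈y , p∈z) with ∈-grid⁻ p∈y | ∈-grid⁻ p∈z
      ... | _ , _ , _ , _ , refl | _ , _ , _ , _ , ()

  length-W-vertices : length W-vertices ≡ 2 + (k * (d ∸ 1) + k * (d ∸ 1))
  length-W-vertices = cong (2 +_) (begin
    length (grid y ++ grid z)           ≡⟨ length-++ (grid y) ⟩
    length (grid y) + length (grid z)   ≡⟨ cong₂ _+_ length-grid length-grid ⟩
    k * (d ∸ 1) + k * (d ∸ 1)           ∎)
    where
    open ≡-Reasoning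
    length-grid : ∀ {c} → length (grid c) ≡ k * (d ∸ 1)
    length-grid {c} = trans (length-cartesianProductWith c (range k) (range (d ∸ 1)))
                            (cong₂ _*_ (length-applyUpTo suc k) (length-applyUpTo suc (d ∸ 1)))

  module XI = Iterated (X'' d k) a (y 1) u id id (λ ()) (λ ()) (λ ()) y-injective u-injective
  module YI = Iterated (Y'' d k) b (y k) w id id (λ ()) (λ ()) (λ ()) y-injective w-injective

  X-from-cl : ∀ {J σ} → cl d k σ → (∀ {t} → ¬ (a ∈ σ × y 1 t ∈ σ)) → X'' d k J σ
  X-from-cl {J} (valid , adjacent) ¬ay =
    XI.lift {j = J} z≤n (valid , adjacent) (λ _ _ u∈ → case All.lookup valid u∈ of λ ()) (λ _ _ → ¬ay)

  X-edge : ∀ J {p q} → E d k p q → p ≢ a → Edge (X'' d k J) p q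
  X-edge J e p≢a = E-irreflexive e , X-from-cl {J} (cl-edge e)
    λ { (here a≡p , _) → p≢a (sym a≡p) ; (there (here refl) , _) → ¬E-to-a e }

  X-edge-az : ∀ J {s} → IsV d k (z 1 s) → Edge (X'' d k J) a (z 1 s)
  X-edge-az J v = (λ ()) , X-from-cl {J} (cl-edge (a-z v)) λ { (_ , here ()) ; (_ , there (here ())) }

  data XVertex (J : ℕ) : Vtx → Set where
    old : ∀ {p} → IsV d k p → XVertex J p
    new : ∀ {s} → 1 ≤ s → s ≤ J → XVertex J (u s)

  X-vertex-class : ∀ {J p} → p ∈ XI.news J ++ W-vertices → XVertex J p
  X-vertex-class {J} p∈ with ∈-++⁻ (XI.news J) p∈
  ... | inj₁ p∈new with XI.∈-news⁻ p∈new
  ...   | _ , 1≤s , s≤J , refl = new 1≤s s≤J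
  X-vertex-class p∈ | inj₂ p∈W = old (∈W⇒IsV p∈W)

  X-enumerates : ∀ {J} → 1 ≤ k → J ≤ d ∸ 1 → Enumerates (X'' d k J) (XI.news J ++ W-vertices)
  X-enumerates {J} 1≤k J≤d = XI.enumerates J
    (λ 1≤s s≤J → cl-edge (a-y (vy ≤-refl 1≤k 1≤s (≤-trans s≤J J≤d))))
    (λ u∈ → case ∈W⇒IsV u∈ of λ ()) cl-enumerates

  Y-from-X : ∀ {J σ} → X'' d k (d ∸ 1) σ → (∀ {t} → w t ∉ σ) → (∀ {t} → ¬ (b ∈ σ × y k t ∈ σ)) →
             Y'' d k J σ
  Y-from-X {J} xσ w∉ ¬by = YI.lift {j = J} z≤n xσ (λ _ _ → w∉) (λ _ _ → ¬by)

  Y-enumerates : ∀ {J} → 1 ≤ k → J ≤ d ∸ 1 →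
                 Enumerates (Y'' d k J) (YI.news J ++ (XI.news (d ∸ 1) ++ W-vertices))
  Y-enumerates {J} 1≤k J≤d = YI.enumerates J
    (λ 1≤s s≤J → proj₂ (X-edge (d ∸ 1) (b-y (vy 1≤k ≤-refl 1≤s (≤-trans s≤J J≤d))) λ ()))
    (λ w∈ → case X-vertex-class w∈ of λ { (old ()) })
    (X-enumerates 1≤k ≤-refl)

  module X-faces (1≤k : 1 ≤ k) {J} (J≤d : J ≤ d ∸ 1) where

    y¹ : ∀ {s} → 1 ≤ s → s ≤ J → IsV d k (y 1 s)
    y¹ 1≤s s≤J = vy ≤-refl 1≤k 1≤s (≤-trans s≤J J≤d)

    edge-ua : ∀ {s} → 1 ≤ s → s ≤ J → Edge (X'' d k J) (u s) a
    edge-ua 1≤s s≤J = XI.edge-to-old 1≤s s≤J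
      (clique (va ∷ v ∷ va ∷ [])
              (((λ _ → inj₁ (a-y v)) ∷ contradiction refl ∷ []) ∷ ((λ _ → inj₂ (a-y v)) ∷ []) ∷ [] ∷ []))
      (λ ()) (λ _ ())
      where v = y¹ 1≤s s≤J

    edge-uy : ∀ {s} → 1 ≤ s → s ≤ J → Edge (X'' d k J) (u s) (y 1 s)
    edge-uy 1≤s s≤J = XI.edge-to-old 1≤s s≤J
      (clique (va ∷ v ∷ v ∷ [])
              (((λ _ → inj₁ (a-y v)) ∷ (λ _ → inj₁ (a-y v)) ∷ []) ∷ (contradiction refl ∷ []) ∷ [] ∷ []))
      (λ ()) (λ { t<s refl → <-irrefl refl t<s })
      where v = y¹ 1≤s s≤J

    edge-uz : ∀ {s t} → 1 ≤ s → s ≤ J → IsV d k (z 1 t) → s ≢ t → Edge (X'' d k J) (u s) (z 1 t)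
    edge-uz 1≤s s≤J v′ s≢t = XI.edge-to-old 1≤s s≤J
      (clique (va ∷ v ∷ v′ ∷ [])
              ( ((λ _ → inj₁ (a-y v)) ∷ (λ _ → inj₁ (a-z v′)) ∷ [])
              ∷ ((λ _ → inj₁ (yz v v′ s≢t)) ∷ [])
              ∷ [] ∷ []))
      (λ ()) (λ _ ())
      where v = y¹ 1≤s s≤J

    edge-uu : ∀ {s t} → 1 ≤ t → t < s → s ≤ J → Edge (X'' d k J) (u s) (u t)
    edge-uu 1≤t t<s s≤J = XI.edge-to-new 1≤t t<s s≤J
      (clique (va ∷ vt ∷ va ∷ vs ∷ [])
              ( ((λ _ → inj₁ (a-y vt)) ∷ contradiction refl ∷ (λ _ → inj₁ (a-y vs)) ∷ [])
              ∷ ((λ _ → inj₂ (a-y vt)) ∷ (λ _ → inj₁ (yy vt vs (<⇒≢ t<s))) ∷ [])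
              ∷ ((λ _ → inj₁ (a-y vs)) ∷ [])
              ∷ [] ∷ []))
      where
      vt = y¹ 1≤t (≤-trans (<⇒≤ t<s) s≤J)
      vs = y¹ (≤-trans 1≤t (<⇒≤ t<s)) s≤J

  lowerIf : ∀ {A : Set} → Dec A → ℕ → ℕ
  lowerIf (yes _) i = i ∸ 1
  lowerIf (no _) i = i

  lowerIf-≤ : ∀ {A : Set} (dec : Dec A) i → lowerIf dec i ≤ i
  lowerIf-≤ (yes _) i = m∸n≤m i 1
  lowerIf-≤ (no _) i = ≤-refl

  module X-upper-bound (1≤k : 1 ≤ k) {J} (J≤d : J ≤ d ∸ 1) {S} (stable-S : Stable (X'' d k J) S) where
    open X-faces 1≤k J≤d

    no-edge : ∀ {p q} → p ∈ S → q ∈ S → ¬ Edge (X'' d k J) p q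
    no-edge p∈ q∈ = proj₂ (proj₂ stable-S) _ _ p∈ q∈

    class : ∀ {p} → p ∈ S → XVertex J p
    class p∈ = X-vertex-class (proj₂ (proj₂ (X-enumerates 1≤k J≤d) _) (All.lookup (proj₁ (proj₂ stable-S)) p∈))

    valid-y : ∀ {i s} → y i s ∈ S → IsV d k (y i s)
    valid-y y∈ with class y∈
    ... | old v = v

    -- Each level is a clique; z^i_s drops to level i - 1 exactly when y^i_s, its only
    -- non-neighbour in X_i, is in S.
    level : Vtx → ℕ
    level a = 0
    level b = k
    level (y i _) = i
    level (z i s) = lowerIf (y i s ∈? S) i
    level (u _) = 0
    level (w _) = 0

    y-positive : ∀ {i s} → IsV d k (y i s) → 0 ≢ i
    y-positive (vy 1≤i _ _ _) refl = 1+n≰n 1≤i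

    clash-a-z : ∀ {i s} → a ∈ S → z i s ∈ S → IsV d k (z i s) → (dec : Dec (y i s ∈ S)) → 0 ≢ lowerIf dec i
    clash-a-z {zero} _ _ (vz () _ _ _) _
    clash-a-z {suc zero} a∈ z∈ v (yes _) _ = no-edge a∈ z∈ (X-edge-az J v)
    clash-a-z {suc (suc _)} _ _ _ (yes _) ()
    clash-a-z {suc _} _ _ _ (no _) ()

    clash-b-y : ∀ {i s} → b ∈ S → y i s ∈ S → IsV d k (y i s) → k ≢ i
    clash-b-y b∈ y∈ v refl = no-edge b∈ y∈ (X-edge J (b-y v) λ ())

    clash-b-z : ∀ {i s} → b ∈ S → z i s ∈ S → IsV d k (z i s) → (dec : Dec (y i s ∈ S)) → k ≢ lowerIf dec i
    clash-b-z {zero} _ _ (vz () _ _ _) _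
    clash-b-z {suc _} _ _ (vz _ i≤k _ _) (yes _) refl = 1+n≰n i≤k
    clash-b-z b∈ z∈ v (no _) refl = no-edge b∈ z∈ (X-edge J (b-z v) λ ())

    clash-y-y : ∀ {i s i′ t} → y i s ∈ S → y i′ t ∈ S → y i s ≢ y i′ t → i ≢ i′
    clash-y-y {s = s} {t = t} y∈ y′∈ p≢q refl with s ≟ t
    ... | yes refl = p≢q refl
    ... | no s≢t = no-edge y∈ y′∈ (X-edge J (yy (valid-y y∈) (valid-y y′∈) s≢t) λ ())

    clash-y-z : ∀ {i s i′ t} → y i s ∈ S → z i′ t ∈ S → IsV d k (z i′ t) → (dec : Dec (y i′ t ∈ S)) →
                i ≢ lowerIf dec i′
    clash-y-z {i′ = zero} _ _ (vz () _ _ _) _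
    clash-y-z {s = s} {i′ = suc _} {t} y∈ z∈ v (yes y′∈) refl with s ≤? t
    ... | yes s≤t = no-edge y∈ y′∈ (X-edge J (yy' (valid-y y∈) (valid-y y′∈) s≤t) λ ())
    ... | no s≰t = no-edge y∈ z∈ (X-edge J (yz' (valid-y y∈) v (≰⇒> s≰t)) λ ())
    clash-y-z {s = s} {t = t} y∈ z∈ v (no y′∉S) refl with s ≟ t
    ... | yes refl = y′∉S y∈
    ... | no s≢t = no-edge y∈ z∈ (X-edge J (yz (valid-y y∈) v s≢t) λ ())

    clash-z-z-mixed : ∀ {i s i′ t} → z i s ∈ S → z i′ t ∈ S → IsV d k (z i s) → IsV d k (z i′ t) →
                      y i s ∈ S → y i′ t ∉ S → i ∸ 1 ≢ i′
    clash-z-z-mixed {zero} _ _ (vz () _ _ _) _ _ _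
    clash-z-z-mixed {suc _} {s} {t = t} z∈ z′∈ v v′ y∈ _ refl with t ≤? s
    ... | yes t≤s = no-edge z′∈ z∈ (X-edge J (zz' v′ v t≤s) λ ())
    ... | no t≰s = no-edge z′∈ y∈ (X-edge J (zy' v′ (valid-y y∈) (≰⇒> t≰s)) λ ())

    clash-z-z : ∀ {i s i′ t} → z i s ∈ S → z i′ t ∈ S → IsV d k (z i s) → IsV d k (z i′ t) →
                z i s ≢ z i′ t → (dec : Dec (y i s ∈ S)) (dec′ : Dec (y i′ t ∈ S)) → lowerIf dec i ≢ lowerIf dec′ i′
    clash-z-z _ _ (vz {zero} () _ _ _) _ _ (yes _) _ _
    clash-z-z _ _ _ (vz {zero} () _ _ _) _ _ (yes _) _
    clash-z-z {suc _} {s} {suc _} {t} _ _ _ _ p≢q (yes y∈) (yes y′∈) refl with s ≟ t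
    ... | yes refl = p≢q refl
    ... | no s≢t = no-edge y∈ y′∈ (X-edge J (yy (valid-y y∈) (valid-y y′∈) s≢t) λ ())
    clash-z-z {s = s} {t = t} z∈ z′∈ v v′ p≢q (no _) (no _) refl with s ≟ t
    ... | yes refl = p≢q refl
    ... | no s≢t = no-edge z∈ z′∈ (X-edge J (zz v v′ s≢t) λ ())
    clash-z-z z∈ z′∈ v v′ _ (yes y∈) (no y′∉S) = clash-z-z-mixed z∈ z′∈ v v′ y∈ y′∉S
    clash-z-z z∈ z′∈ v v′ _ (no y∉S) (yes y′∈) = clash-z-z-mixed z′∈ z∈ v′ v y′∈ y∉S ∘ sym

    clash-u-z : ∀ {s i t} → u s ∈ S → z i t ∈ S → 1 ≤ s → s ≤ J → IsV d k (z i t) →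
                (dec : Dec (y i t ∈ S)) → 0 ≢ lowerIf dec i
    clash-u-z _ _ _ _ (vz {zero} () _ _ _) _
    clash-u-z {s} {suc zero} {t} u∈ z∈ 1≤s s≤J v (yes y∈) _ with s ≟ t
    ... | yes refl = no-edge u∈ y∈ (edge-uy 1≤s s≤J)
    ... | no s≢t = no-edge u∈ z∈ (edge-uz 1≤s s≤J v s≢t)
    clash-u-z {i = suc (suc _)} _ _ _ _ _ (yes _) ()
    clash-u-z {i = suc _} _ _ _ _ _ (no _) ()

    clash-u-u : ∀ {s t} → u s ∈ S → u t ∈ S → 1 ≤ s → s ≤ J → 1 ≤ t → t ≤ J → s ≢ t → ⊥
    clash-u-u {s} {t} u∈ u′∈ 1≤s s≤J 1≤t t≤J s≢t with t <? s
    ... | yes t<s = no-edge u∈ u′∈ (edge-uu 1≤t t<s s≤J)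
    ... | no t≮s = no-edge u′∈ u∈ (edge-uu 1≤s (≤∧≢⇒< (≮⇒≥ t≮s) s≢t) t≤J)

    clash : ∀ {p q} → p ∈ S → q ∈ S → XVertex J p → XVertex J q → p ≢ q → level p ≢ level q
    clash _ _ (old va) (old va) p≢q _ = p≢q refl
    clash _ _ (old va) (old vb) _ 0≡k = 1+n≰n (≤-trans 1≤k (≤-reflexive (sym 0≡k)))
    clash _ _ (old va) (old v@(vy _ _ _ _)) _ = y-positive v
    clash p∈ q∈ (old va) (old v@(vz _ _ _ _)) _ = clash-a-z p∈ q∈ v (_ ∈? S)
    clash p∈ q∈ (old va) (new 1≤s s≤J) _ _ = no-edge q∈ p∈ (edge-ua 1≤s s≤J)
    clash _ _ (old vb) (old va) _ k≡0 = 1+n≰n (≤-trans 1≤k (≤-reflexive k≡0))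
    clash _ _ (old vb) (old vb) p≢q _ = p≢q refl
    clash p∈ q∈ (old vb) (old v@(vy _ _ _ _)) _ = clash-b-y p∈ q∈ v
    clash p∈ q∈ (old vb) (old v@(vz _ _ _ _)) _ = clash-b-z p∈ q∈ v (_ ∈? S)
    clash _ _ (old vb) (new _ _) _ k≡0 = 1+n≰n (≤-trans 1≤k (≤-reflexive k≡0))
    clash _ _ (old v@(vy _ _ _ _)) (old va) _ = y-positive v ∘ sym
    clash p∈ q∈ (old v@(vy _ _ _ _)) (old vb) _ = clash-b-y q∈ p∈ v ∘ sym
    clash p∈ q∈ (old (vy _ _ _ _)) (old (vy _ _ _ _)) p≢q = clash-y-y p∈ q∈ p≢q
    clash p∈ q∈ (old (vy _ _ _ _)) (old v@(vz _ _ _ _)) _ = clash-y-z p∈ q∈ v (_ ∈? S)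
    clash _ _ (old v@(vy _ _ _ _)) (new _ _) _ = y-positive v ∘ sym
    clash p∈ q∈ (old v@(vz _ _ _ _)) (old va) _ = clash-a-z q∈ p∈ v (_ ∈? S) ∘ sym
    clash p∈ q∈ (old v@(vz _ _ _ _)) (old vb) _ = clash-b-z q∈ p∈ v (_ ∈? S) ∘ sym
    clash p∈ q∈ (old v@(vz _ _ _ _)) (old (vy _ _ _ _)) _ = clash-y-z q∈ p∈ v (_ ∈? S) ∘ sym
    clash p∈ q∈ (old v@(vz _ _ _ _)) (old v′@(vz _ _ _ _)) p≢q = clash-z-z p∈ q∈ v v′ p≢q (_ ∈? S) (_ ∈? S)
    clash p∈ q∈ (old v@(vz _ _ _ _)) (new 1≤s s≤J) _ = clash-u-z q∈ p∈ 1≤s s≤J v (_ ∈? S) ∘ sym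
    clash p∈ q∈ (new 1≤s s≤J) (old va) _ _ = no-edge p∈ q∈ (edge-ua 1≤s s≤J)
    clash _ _ (new _ _) (old vb) _ 0≡k = 1+n≰n (≤-trans 1≤k (≤-reflexive (sym 0≡k)))
    clash _ _ (new _ _) (old v@(vy _ _ _ _)) _ = y-positive v
    clash p∈ q∈ (new 1≤s s≤J) (old v@(vz _ _ _ _)) _ = clash-u-z p∈ q∈ 1≤s s≤J v (_ ∈? S)
    clash p∈ q∈ (new 1≤s s≤J) (new 1≤t t≤J) p≢q _ = clash-u-u p∈ q∈ 1≤s s≤J 1≤t t≤J (p≢q ∘ cong u)

    level-injective : ∀ {p q} → p ∈ S → q ∈ S → level p ≡ level q → p ≡ q
    level-injective {p} {q} p∈ q∈ same with p ≟ᵥ q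
    ... | yes p≡q = p≡q
    ... | no p≢q = contradiction same (clash p∈ q∈ (class p∈) (class q∈) p≢q)

    level-bounded : ∀ {p} → XVertex J p → level p < suc k
    level-bounded (old va) = s≤s z≤n
    level-bounded (old vb) = ≤-refl
    level-bounded (old (vy _ i≤k _ _)) = s≤s i≤k
    level-bounded (old (vz {i} {s} _ i≤k _ _)) = s≤s (≤-trans (lowerIf-≤ (y i s ∈? S) i) i≤k)
    level-bounded (new _ _) = s≤s z≤n

    bound : length S ≤ suc k
    bound = pigeonhole level (suc k) (proj₁ stable-S) level-injective (level-bounded ∘ class)

  data Apex : Vtx → Set where
    apex-b : Apex b
    apex-w : ∀ {s} → Apex (w s)

  apex? : Decidable Apex
  apex? a = no λ ()
  apex? b = yes apex-b
  apex? (y _ _) = no λ ()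
  apex? (z _ _) = no λ ()
  apex? (u _) = no λ ()
  apex? (w _) = yes apex-w

  module Y-faces (1≤k : 1 ≤ k) {J} (J≤d : J ≤ d ∸ 1) where

    yᵏ : ∀ {s} → 1 ≤ s → s ≤ J → IsV d k (y k s)
    yᵏ 1≤s s≤J = vy 1≤k ≤-refl 1≤s (≤-trans s≤J J≤d)

    without-a : ∀ {σ} → a ∉ σ → ∀ {t} → ¬ (a ∈ σ × y 1 t ∈ σ)
    without-a a∉σ (a∈σ , _) = a∉σ a∈σ

    edge-wb : ∀ {s} → 1 ≤ s → s ≤ J → Edge (Y'' d k J) (w s) b
    edge-wb 1≤s s≤J = YI.edge-to-old 1≤s s≤J
      (X-from-cl {d ∸ 1}
        (clique (vb ∷ v ∷ vb ∷ [])
                (((λ _ → inj₁ (b-y v)) ∷ contradiction refl ∷ []) ∷ ((λ _ → inj₂ (b-y v)) ∷ []) ∷ [] ∷ []))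
        (without-a (All¬⇒¬Any ((λ ()) ∷ (λ ()) ∷ (λ ()) ∷ []))))
      (λ ()) (λ _ ())
      where v = yᵏ 1≤s s≤J

    edge-ww : ∀ {s t} → 1 ≤ t → t < s → s ≤ J → Edge (Y'' d k J) (w s) (w t)
    edge-ww 1≤t t<s s≤J = YI.edge-to-new 1≤t t<s s≤J
      (X-from-cl {d ∸ 1}
        (clique (vb ∷ vt ∷ vb ∷ vs ∷ [])
                ( ((λ _ → inj₁ (b-y vt)) ∷ contradiction refl ∷ (λ _ → inj₁ (b-y vs)) ∷ [])
                ∷ ((λ _ → inj₂ (b-y vt)) ∷ (λ _ → inj₁ (yy vt vs (<⇒≢ t<s))) ∷ [])
                ∷ ((λ _ → inj₁ (b-y vs)) ∷ [])
                ∷ [] ∷ []))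
        (without-a (All¬⇒¬Any ((λ ()) ∷ (λ ()) ∷ (λ ()) ∷ (λ ()) ∷ []))))
      where
      vt = yᵏ 1≤t (≤-trans (<⇒≤ t<s) s≤J)
      vs = yᵏ (≤-trans 1≤t (<⇒≤ t<s)) s≤J

    edge-from-X : ∀ {p q} → ¬ Apex p → ¬ Apex q → Edge (X'' d k (d ∸ 1)) p q → Edge (Y'' d k J) p q
    edge-from-X ¬apex-p ¬apex-q (p≢q , xpq) = p≢q , Y-from-X {J} xpq
      (All¬⇒¬Any ((λ { refl → ¬apex-p apex-w }) ∷ (λ { refl → ¬apex-q apex-w }) ∷ []))
      λ { (here refl , _) → ¬apex-p apex-b ; (there (here refl) , _) → ¬apex-q apex-b }

  module Y-upper-bound (1≤k : 1 ≤ k) {J} (J≤d : J ≤ d ∸ 1) {S} (stable-S : Stable (Y'' d k J) S) where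
    open Y-faces 1≤k J≤d

    no-edge : ∀ {p q} → p ∈ S → q ∈ S → ¬ Edge (Y'' d k J) p q
    no-edge p∈ q∈ = proj₂ (proj₂ stable-S) _ _ p∈ q∈

    vertex-class : ∀ {p} → p ∈ S → p ∈ YI.news J ⊎ p ∈ XI.news (d ∸ 1) ++ W-vertices
    vertex-class p∈ =
      ∈-++⁻ (YI.news J) (proj₂ (proj₂ (Y-enumerates 1≤k J≤d) _) (All.lookup (proj₁ (proj₂ stable-S)) p∈))

    valid-w : ∀ {s} → w s ∈ S → 1 ≤ s × s ≤ J
    valid-w w∈ with vertex-class w∈
    ... | inj₁ w∈new with YI.∈-news⁻ w∈new
    ...   | _ , 1≤s , s≤J , refl = 1≤s , s≤J
    valid-w w∈ | inj₂ w∈X = case X-vertex-class w∈X of λ { (old ()) }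

    apexes-equal : ∀ {p q} → p ∈ S → q ∈ S → Apex p → Apex q → p ≡ q
    apexes-equal _ _ apex-b apex-b = refl
    apexes-equal b∈ w∈ apex-b apex-w = ⊥-elim (no-edge w∈ b∈ (uncurry edge-wb (valid-w w∈)))
    apexes-equal w∈ b∈ apex-w apex-b = ⊥-elim (no-edge w∈ b∈ (uncurry edge-wb (valid-w w∈)))
    apexes-equal {w s} {w t} w∈ w′∈ apex-w apex-w with <-cmp t s
    ... | tri< t<s _ _ = ⊥-elim (no-edge w∈ w′∈ (edge-ww (proj₁ (valid-w w′∈)) t<s (proj₂ (valid-w w∈))))
    ... | tri≈ _ refl _ = refl
    ... | tri> _ _ s<t = ⊥-elim (no-edge w′∈ w∈ (edge-ww (proj₁ (valid-w w∈)) s<t (proj₂ (valid-w w′∈))))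

    at-most-one-apex : length (filter apex? S) ≤ 1
    at-most-one-apex = length≤1 (Unique.filter⁺ apex? (proj₁ stable-S)) λ p∈ q∈ →
      let p∈S , apex-p = ∈-filter⁻ apex? p∈ ; q∈S , apex-q = ∈-filter⁻ apex? q∈
      in apexes-equal p∈S q∈S apex-p apex-q

    non-apex-in-X : ∀ {p} → p ∈ S → ¬ Apex p → Vert (X'' d k (d ∸ 1)) p
    non-apex-in-X p∈ ¬apex with vertex-class p∈
    ... | inj₁ p∈new with YI.∈-news⁻ p∈new
    ...   | _ , _ , _ , refl = ⊥-elim (¬apex apex-w)
    non-apex-in-X p∈ ¬apex | inj₂ p∈X = proj₁ (proj₂ (X-enumerates 1≤k ≤-refl) _) p∈X

    stable-in-X : Stable (X'' d k (d ∸ 1)) (filter (∁? apex?) S)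
    stable-in-X = Unique.filter⁺ (∁? apex?) (proj₁ stable-S)
                , All.tabulate (uncurry non-apex-in-X ∘ ∈-filter⁻ (∁? apex?))
                , no-X-edge
      where
      no-X-edge : ∀ p q → p ∈ filter (∁? apex?) S → q ∈ filter (∁? apex?) S → ¬ Edge (X'' d k (d ∸ 1)) p q
      no-X-edge p q p∈ q∈ =
        let p∈S , ¬apex-p = ∈-filter⁻ (∁? apex?) p∈ ; q∈S , ¬apex-q = ∈-filter⁻ (∁? apex?) q∈
        in no-edge p∈S q∈S ∘ edge-from-X ¬apex-p ¬apex-q

    bound : length S ≤ suc (suc k)
    bound = begin
      length S                                                 ≡⟨ length-partition apex? S ⟩
      length (filter apex? S) + length (filter (∁? apex?) S)   ≤⟨ +-mono-≤ at-most-one-apex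
                                                                  (X-upper-bound.bound 1≤k ≤-refl stable-in-X) ⟩
      1 + suc k                                                ∎
      where open ≤-Reasoning

  module NonAdjacency {K} (old-pairs : OldPairsIn K (IsV d k) (Adj d k)) where

    nonAdjacent : ∀ {p q} → IsV d k p → IsV d k q → p ≢ q → ¬ Adj d k p q → NonAdjacent K p q
    nonAdjacent vp vq p≢q ¬adj =
      p≢q , (λ (_ , kpq) → ¬adj (old-pairs kpq (here refl) (there (here refl)) p≢q vp vq))
          , (λ (_ , kqp) → ¬adj (swap (old-pairs kqp (here refl) (there (here refl)) (p≢q ∘ sym) vq vp)))

    layer-gap : ∀ {p q} → IsV d k p → IsV d k q → 2 + layer p ≤ layer q → NonAdjacent K p q
    layer-gap vp vq gap = nonAdjacent vp vq (λ { refl → 1+n≰n (≤-trans (n≤1+n _) gap) }) (layer-gap⇒¬Adj gap)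

  pairs-below : ℕ → List Vtx
  pairs-below zero = []
  pairs-below (suc zero) = [ a ]
  pairs-below (suc (suc n)) = y (suc n) 1 ∷ z (suc n) 1 ∷ pairs-below n

  length-pairs-below : ∀ n → length (pairs-below n) ≡ n
  length-pairs-below zero = refl
  length-pairs-below (suc zero) = refl
  length-pairs-below (suc (suc n)) = cong (2 +_) (length-pairs-below n)

  pairs-below-valid : ∀ {n p} → 2 ≤ d → n ≤ k → p ∈ pairs-below n → IsV d k p × layer p < n
  pairs-below-valid {suc zero} _ _ (here refl) = va , ≤-refl
  pairs-below-valid {suc (suc n)} 2≤d n≤k (here refl) =
    vy (s≤s z≤n) (<⇒≤ n≤k) ≤-refl (∸-monoˡ-≤ 1 2≤d) , ≤-refl
  pairs-below-valid {suc (suc n)} 2≤d n≤k (there (here refl)) =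
    vz (s≤s z≤n) (<⇒≤ n≤k) ≤-refl (∸-monoˡ-≤ 1 2≤d) , ≤-refl
  pairs-below-valid {suc (suc n)} 2≤d n≤k (there (there p∈)) =
    let vp , p<n = pairs-below-valid 2≤d (≤-trans (n≤1+n n) (<⇒≤ n≤k)) p∈
    in vp , m≤n⇒m≤1+n (m≤n⇒m≤1+n p<n)

  -- Below y^2_1 the zigzag uses y^1_2 rather than y^1_1, since y^1_1 y^2_1 is an edge;
  -- this is where d ≥ 3 is needed.
  zig : ℕ → Bool → Vtx
  zig zero true = y 1 1
  zig zero false = y 1 2
  zig (suc n) true = y (2 + n) 1
  zig (suc n) false = z (2 + n) 1

  zigzag : ℕ → Bool → List Vtx
  zigzag zero _ = []
  zigzag (suc n) t = zig n t ∷ zigzag n (not t)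

  length-zigzag : ∀ n t → length (zigzag n t) ≡ n
  length-zigzag zero _ = refl
  length-zigzag (suc n) t = cong suc (length-zigzag n (not t))

  zig-layer : ∀ n t → layer (zig n t) ≡ suc n
  zig-layer zero true = refl
  zig-layer zero false = refl
  zig-layer (suc n) true = refl
  zig-layer (suc n) false = refl

  zig-valid : ∀ {n} t → 3 ≤ d → n < k → IsV d k (zig n t)
  zig-valid {zero} true 3≤d n<k = vy ≤-refl n<k ≤-refl (≤-trans (s≤s z≤n) (∸-monoˡ-≤ 1 3≤d))
  zig-valid {zero} false 3≤d n<k = vy ≤-refl n<k (s≤s z≤n) (∸-monoˡ-≤ 1 3≤d)
  zig-valid {suc n} true 3≤d n<k = vy (s≤s z≤n) n<k ≤-refl (≤-trans (s≤s z≤n) (∸-monoˡ-≤ 1 3≤d))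
  zig-valid {suc n} false 3≤d n<k = vz (s≤s z≤n) n<k ≤-refl (≤-trans (s≤s z≤n) (∸-monoˡ-≤ 1 3≤d))

  zigzag-valid : ∀ {n t p} → 3 ≤ d → n ≤ k → p ∈ zigzag n t → IsV d k p × layer p ≤ n
  zigzag-valid {suc n} {t} 3≤d n≤k (here refl) = zig-valid t 3≤d n≤k , ≤-reflexive (zig-layer n t)
  zigzag-valid {suc n} 3≤d n≤k (there p∈) =
    let vp , p≤n = zigzag-valid 3≤d (≤-trans (n≤1+n n) n≤k) p∈ in vp , m≤n⇒m≤1+n p≤n

  zig-step : ∀ n t → ¬ Adj d k (zig (suc n) t) (zig n (not t))
  zig-step zero true = λ { (inj₁ ()) ; (inj₂ (yy' _ _ (s≤s ()))) }
  zig-step zero false = λ { (inj₁ ()) ; (inj₂ (yz' _ _ (s≤s ()))) }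
  zig-step (suc n) true = λ { (inj₁ ()) ; (inj₂ (zy' _ _ (s≤s ()))) }
  zig-step (suc n) false = λ { (inj₁ ()) ; (inj₂ (yz' _ _ (s≤s ()))) }

  module Lower-bound {K} (old-pairs : OldPairsIn K (IsV d k) (Adj d k)) where
    open NonAdjacency old-pairs

    pairs-below-nonAdjacent : ∀ {n} → 2 ≤ d → n ≤ k → AllPairs (NonAdjacent K) (pairs-below n)
    pairs-below-nonAdjacent {zero} _ _ = []
    pairs-below-nonAdjacent {suc zero} _ _ = [] ∷ []
    pairs-below-nonAdjacent {suc (suc n)} 2≤d n≤k =
        ( nonAdjacent vy₁ vz₁ (λ ()) (λ { (inj₁ (yz _ _ 1≢1)) → 1≢1 refl ; (inj₂ ()) })
        ∷ All.tabulate (above vy₁ refl))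
      ∷ All.tabulate (above vz₁ refl)
      ∷ pairs-below-nonAdjacent 2≤d n≤k′
      where
      n≤k′ = ≤-trans (n≤1+n n) (<⇒≤ n≤k)
      vy₁ = proj₁ (pairs-below-valid 2≤d n≤k (here refl))
      vz₁ = proj₁ (pairs-below-valid 2≤d n≤k (there (here refl)))
      above : ∀ {p q} → IsV d k p → layer p ≡ suc n → q ∈ pairs-below n → NonAdjacent K p q
      above vp layer-p q∈ = let vq , q<n = pairs-below-valid 2≤d n≤k′ q∈
                            in nonAdjacent-sym {K} (layer-gap vq vp (subst (_ ≤_) (sym layer-p) (s≤s q<n)))

    X-list-nonAdjacent : 2 ≤ d → AllPairs (NonAdjacent K) (b ∷ pairs-below k)
    X-list-nonAdjacent 2≤d =
        All.tabulate (λ q∈ → let vq , q<k = pairs-below-valid 2≤d ≤-refl q∈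
                             in nonAdjacent-sym {K} (layer-gap vq vb (s≤s q<k)))
      ∷ pairs-below-nonAdjacent 2≤d ≤-refl

    zigzag-nonAdjacent : ∀ {n} t → 3 ≤ d → n ≤ k → AllPairs (NonAdjacent K) (zigzag n t)
    zigzag-nonAdjacent {zero} _ _ _ = []
    zigzag-nonAdjacent {suc zero} _ _ _ = [] ∷ []
    zigzag-nonAdjacent {suc (suc m)} t 3≤d 1+m<k =
        ( nonAdjacent v-top v-next (λ e → 1+n≢n (trans (sym (zig-layer (suc m) t))
                                                       (trans (cong layer e) (zig-layer m (not t)))))
                      (zig-step m t)
        ∷ All.tabulate far)
      ∷ zigzag-nonAdjacent (not t) 3≤d (<⇒≤ 1+m<k)
      where
      v-top = zig-valid t 3≤d 1+m<k
      v-next = zig-valid (not t) 3≤d (<⇒≤ 1+m<k)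
      far : ∀ {q} → q ∈ zigzag m (not (not t)) → NonAdjacent K (zig (suc m) t) q
      far q∈ = let vq , q≤m = zigzag-valid 3≤d (≤-trans (n≤1+n m) (<⇒≤ 1+m<k)) q∈
               in nonAdjacent-sym {K} (layer-gap vq v-top (subst (_ ≤_) (sym (zig-layer (suc m) t)) (s≤s (s≤s q≤m))))

    a-zigzag : ∀ {n} t → 3 ≤ d → n ≤ k → NoPair K a (y 1 1) → NoPair K a (y 1 2) →
               All (NonAdjacent K a) (zigzag n t)
    a-zigzag {zero} _ _ _ _ _ = []
    a-zigzag {suc zero} true _ _ sep₁ _ = nonAdjacent-noPair (λ ()) sep₁ ∷ []
    a-zigzag {suc zero} false _ _ _ sep₂ = nonAdjacent-noPair (λ ()) sep₂ ∷ []
    a-zigzag {suc (suc m)} t 3≤d 1+m<k sep₁ sep₂ =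
        layer-gap va (zig-valid t 3≤d 1+m<k) (subst (2 ≤_) (sym (zig-layer (suc m) t)) (s≤s (s≤s z≤n)))
      ∷ a-zigzag (not t) 3≤d (<⇒≤ 1+m<k) sep₁ sep₂

    b-zigzag : ∀ n → n ≡ k → 3 ≤ d → NoPair K b (y k 1) → All (NonAdjacent K b) (zigzag n true)
    b-zigzag zero _ _ _ = []
    b-zigzag (suc zero) refl _ sep = nonAdjacent-noPair (λ ()) sep ∷ []
    b-zigzag (suc (suc m)) refl 3≤d sep =
        nonAdjacent-noPair (λ ()) sep
      ∷ All.tabulate λ q∈ → let vq , q≤m = zigzag-valid 3≤d (n≤1+n _) q∈
                            in nonAdjacent-sym {K} (layer-gap vq vb (s≤s (s≤s q≤m)))

    Y-list-nonAdjacent : 3 ≤ d → 1 ≤ k → NoPair K a (y 1 1) → NoPair K a (y 1 2) → NoPair K b (y k 1) →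
                         AllPairs (NonAdjacent K) (a ∷ b ∷ zigzag k true)
    Y-list-nonAdjacent 3≤d 1≤k sep₁ sep₂ sep-b =
        (layer-gap va vb (s≤s 1≤k) ∷ a-zigzag true 3≤d ≤-refl sep₁ sep₂)
      ∷ b-zigzag k refl 3≤d sep-b
      ∷ zigzag-nonAdjacent true 3≤d ≤-refl

  X-vertex : ∀ {J p} → 1 ≤ k → J ≤ d ∸ 1 → IsV d k p → Vert (X'' d k J) p
  X-vertex {J} 1≤k J≤d v = proj₁ (proj₂ (X-enumerates 1≤k J≤d) _) (∈-++⁺ʳ (XI.news J) (IsV⇒∈W v))

  Y-vertex : ∀ {J p} → 1 ≤ k → J ≤ d ∸ 1 → IsV d k p → Vert (Y'' d k J) p
  Y-vertex {J} 1≤k J≤d v =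
    proj₁ (proj₂ (Y-enumerates 1≤k J≤d) _) (∈-++⁺ʳ (YI.news J) (∈-++⁺ʳ (XI.news (d ∸ 1)) (IsV⇒∈W v)))

  X-oldPairs : ∀ J → OldPairsIn (X'' d k J) (IsV d k) (Adj d k)
  X-oldPairs J = XI.oldPairs-lift {J} (λ ()) cl-oldPairs

  Y-oldPairs : ∀ J → OldPairsIn (Y'' d k J) (IsV d k) (Adj d k)
  Y-oldPairs J = YI.oldPairs-lift {J} (λ ()) (X-oldPairs (d ∸ 1))

  X-alpha : ∀ {J} → 2 ≤ d → 1 ≤ k → J ≤ d ∸ 1 → IsAlpha (X'' d k J) (k + 1)
  X-alpha {J} 2≤d 1≤k J≤d =
      ( b ∷ pairs-below k
      , stable {X'' d k J} (X-list-nonAdjacent 2≤d)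
               (X-vertex 1≤k J≤d vb ∷ All.tabulate (X-vertex 1≤k J≤d ∘ proj₁ ∘ pairs-below-valid 2≤d ≤-refl))
      , trans (cong suc (length-pairs-below k)) (+-comm 1 k))
    , λ S stable-S → subst (length S ≤_) (+-comm 1 k) (X-upper-bound.bound 1≤k J≤d stable-S)
    where open Lower-bound (X-oldPairs J)

  Y-alpha : ∀ {J} → 3 ≤ d → 1 ≤ k → 1 ≤ J → J ≤ d ∸ 1 → IsAlpha (Y'' d k J) (k + 2)
  Y-alpha {J} 3≤d 1≤k 1≤J J≤d =
      ( a ∷ b ∷ zigzag k true
      , stable {Y'' d k J}
               (Y-list-nonAdjacent 3≤d 1≤k (a-separated (≤-trans (s≤s z≤n) 2≤d-1)) (a-separated 2≤d-1)
                                   (YI.separated {J} ≤-refl 1≤J))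
               (Y-vertex 1≤k J≤d va ∷ Y-vertex 1≤k J≤d vb
                 ∷ All.tabulate (Y-vertex 1≤k J≤d ∘ proj₁ ∘ zigzag-valid 3≤d ≤-refl))
      , trans (cong (2 +_) (length-zigzag k true)) (+-comm 2 k))
    , λ S stable-S → subst (length S ≤_) (+-comm 2 k) (Y-upper-bound.bound 1≤k J≤d stable-S)
    where
    open Lower-bound (Y-oldPairs J)
    2≤d-1 : 2 ≤ d ∸ 1
    2≤d-1 = ∸-monoˡ-≤ 1 3≤d
    a-separated : ∀ {s} → suc s ≤ d ∸ 1 → NoPair (Y'' d k J) a (y 1 (suc s))
    a-separated s<d = YI.noPair-lift {J} (λ ()) (λ ()) (XI.separated {d ∸ 1} (s≤s z≤n) s<d)

  2d∸2≡2[d∸1] : 2 * d ∸ 2 ≡ 2 * (d ∸ 1)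
  2d∸2≡2[d∸1] = sym (*-distribˡ-∸ 2 d 1)

  X-vertex-count : ∀ {J} → 1 ≤ k → J ≤ d ∸ 1 →
                   Σ ℕ λ N → NumVerts (X'' d k J) N × N ≡ 2 + J + k * (2 * d ∸ 2)
  X-vertex-count {J} 1≤k J≤d = _ , enumerates⇒numVerts (X'' d k J) (X-enumerates 1≤k J≤d) , (begin
    length (XI.news J ++ W-vertices)             ≡⟨ length-++ (XI.news J) ⟩
    length (XI.news J) + length W-vertices       ≡⟨ cong₂ _+_ (XI.length-news J) length-W-vertices ⟩
    J + (2 + (k * (d ∸ 1) + k * (d ∸ 1)))        ≡⟨ arithmetic J (d ∸ 1) k ⟩
    2 + J + k * (2 * (d ∸ 1))                    ≡⟨ cong (λ m → 2 + J + k * m) 2d∸2≡2[d∸1] ⟨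
    2 + J + k * (2 * d ∸ 2)                      ∎)
    where
    open ≡-Reasoning
    arithmetic : ∀ J D k → J + (2 + (k * D + k * D)) ≡ 2 + J + k * (2 * D)
    arithmetic = solve-∀

  Y-vertex-count : ∀ {J} → 1 ≤ k → J ≤ d ∸ 1 →
                   Σ ℕ λ N → NumVerts (Y'' d k J) N × N + (d ∸ 1 ∸ J) ≡ 2 + (k + 1) * (2 * d ∸ 2)
  Y-vertex-count {J} 1≤k J≤d = _ , enumerates⇒numVerts (Y'' d k J) (Y-enumerates 1≤k J≤d) , (begin
    length (YI.news J ++ (XI.news D ++ W-vertices)) + (D ∸ J)
      ≡⟨ cong (_+ (D ∸ J)) (trans (length-++ (YI.news J)) (cong₂ _+_ (YI.length-news J)
                                   (trans (length-++ (XI.news D)) (cong₂ _+_ (XI.length-news D) length-W-vertices)))) ⟩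
    J + (D + (2 + (k * D + k * D))) + (D ∸ J)     ≡⟨ regroup J D (D ∸ J) k ⟩
    J + (D ∸ J) + (D + (2 + (k * D + k * D)))     ≡⟨ cong (_+ (D + (2 + (k * D + k * D)))) (m+[n∸m]≡n J≤d) ⟩
    D + (D + (2 + (k * D + k * D)))               ≡⟨ collect D k ⟩
    2 + (k + 1) * (2 * D)                         ≡⟨ cong (λ m → 2 + (k + 1) * m) 2d∸2≡2[d∸1] ⟨
    2 + (k + 1) * (2 * d ∸ 2)                     ∎)
    where
    open ≡-Reasoning
    D = d ∸ 1
    regroup : ∀ J D E k → J + (D + (2 + (k * D + k * D))) + E ≡ J + E + (D + (2 + (k * D + k * D)))
    regroup = solve-∀
    collect : ∀ D k → D + (D + (2 + (k * D + k * D))) ≡ 2 + (k + 1) * (2 * D)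
    collect = solve-∀

theorem2p1 :
    ((d k j : ℕ) → 2 ≤ d → 1 ≤ k → j ≤ d ∸ 1 →
      IsAlpha (X'' d k j) (k + 1)
      × Σ ℕ (λ N → NumVerts (X'' d k j) N × N ≡ 2 + j + k * (2 * d ∸ 2)))
    × ((d k j : ℕ) → 3 ≤ d → 1 ≤ k → 1 ≤ j → j ≤ d ∸ 1 →
      IsAlpha (Y'' d k j) (k + 2)
      × Σ ℕ (λ N → NumVerts (Y'' d k j) N × N + (d ∸ 1 ∸ j) ≡ 2 + (k + 1) * (2 * d ∸ 2)))
theorem2p1 =
    (λ d k j 2≤d 1≤k j≤d → let open W d k in X-alpha 2≤d 1≤k j≤d , X-vertex-count 1≤k j≤d)
  , (λ d k j 3≤d 1≤k 1≤j j≤d → let open W d k in Y-alpha 3≤d 1≤k 1≤j j≤d , Y-vertex-count 1≤k j≤d)
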